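{- Let $\tilde{\mathcal B}=\langle \mathcal{B}, \leq, \wp(\mathcal B),\wp(\mathcal B), \tilde\top, \tilde\bot, \tilde\Rightarrow, \tilde\wedge, \tilde\vee, \tilde\forall, \tilde\exists\rangle$ be a full pseudo-Heyting algebra and $a\in\mathcal B$. Then its $a$-translation $\tilde{\mathcal B}^a$ is a full pseudo-Heyting algebra.
   Context: A pseudo-Heyting algebra (pHA) is a structure $\langle \mathcal{B}, \leq, \mathcal A,\mathcal E, \tilde\top, \tilde\bot, \tilde\Rightarrow, \tilde\wedge, \tilde\vee, \tilde\forall, \tilde\exists\rangle$ with $\mathcal A,\mathcal E\subseteq\wp(\mathcal B)$, $\tilde\forall:\mathcal A\to\mathcal B$, $\tilde\exists:\mathcal E\to\mathcal B$, binary operations $\tilde\Rightarrow,\tilde\wedge,\tilde\vee$ on $\mathcal B$, such that for all $a,b,c\in\mathcal B$, $A\in\mathcal A$, $E\in\mathcal E$: $\le$ is reflexive and transitive; $a\le\tilde\top$, $\tilde\bot\le a$; $a\tilde\wedge b\le a$, $a\tilde\wedge b\le b$, and $c\le a,c\le b$ imply $c\le a\tilde\wedge b$; $a\le a\tilde\vee b$, $b\le a\tilde\vee b$, and $a\le c,b\le c$ imply $a\tilde\vee b\le c$; $\tilde\forall A\le x$ for all $x\in A$, and $b\le x$ for all $x\in A$ implies $b\le\tilde\forall A$; $x\le\tilde\exists E$ for all $x\in E$, and $x\le b$ for all $x\in E$ implies $\tilde\exists E\le b$; $a\le b\tilde\Rightarrow c$ iff $a\tilde\wedge b\le c$. It is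 full if $\mathcal A=\mathcal E=\wp(\mathcal B)$. $\tilde\Rightarrow$ is read left-associatively: $b\tilde\Rightarrow a\tilde\Rightarrow a$ means $(b\tilde\Rightarrow a)\tilde\Rightarrow a$; for $A\subseteq\mathcal B$, $A\tilde\Rightarrow a\tilde\Rightarrow a=\{(b\tilde\Rightarrow a)\tilde\Rightarrow a\mid b\in A\}$. The $a$-translation of $\tilde{\mathcal B}$ is $\tilde{\mathcal B}^a=\langle\mathcal B,\le_a,\wp(\mathcal B),\wp(\mathcal B),\tilde\top,\tilde\bot,\tilde\Rightarrow_a,\tilde\wedge_a,\tilde\vee_a,\tilde\forall_a,\tilde\exists_a\rangle$ where $b\le_a c$ iff $(b\tilde\Rightarrow a)\tilde\Rightarrow a\le(c\tilde\Rightarrow a)\tilde\Rightarrow a$; $b\,\tilde\Rightarrow_a c=((b\tilde\Rightarrow a)\tilde\Rightarrow a)\tilde\Rightarrow((c\tilde\Rightarrow a)\tilde\Rightarrow a)$, and similarly $b\,\tilde\wedge_a c$, $b\,\tilde\vee_a c$ with $\tilde\wedge,\tilde\vee$ in the middle; $\tilde\forall_a A=\tilde\forall(A\tilde\Rightarrow a\tilde\Rightarrow a)$; $\tilde\exists_a A=\tilde\exists(A\tilde\Rightarrow a\tilde\Rightarrow a)$. -}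

module Defs where

open import Level using (Level; _⊔_) renaming (suc to lsuc)
open import Data.Product using (Σ; _×_; _,_)
open import Relation.Binary.PropositionalEquality using (_≡_)
open import Relation.Unary using (Pred; _∈_)

-- Subsets of the carrier (elements of ℘(B)) are predicates on the carrier
-- at the carrier's universe level.

-- The axioms of a FULL pseudo-Heyting algebra (𝒜 = ℰ = ℘(B)), on given data.
record IsFullPHA {c ℓ : Level} (B : Set c) (_≤_ : B → B → Set ℓ)
                 (⊤̃ ⊥̃ : B) (_⇒̃_ _∧̃_ _∨̃_ : B → B → B)
                 (∀̃ ∃̃ : Pred B c → B) : Set (lsuc c ⊔ ℓ) where
  field
    ≤-refl    : ∀ a → a ≤ a
    ≤-trans   : ∀ {a b d} → a ≤ b → b ≤ d → a ≤ d
    ≤-⊤       : ∀ a → a ≤ ⊤̃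
    ⊥-≤       : ∀ a → ⊥̃ ≤ a
    ∧-lb₁     : ∀ a b → (a ∧̃ b) ≤ a
    ∧-lb₂     : ∀ a b → (a ∧̃ b) ≤ b
    ∧-glb     : ∀ a b d → d ≤ a → d ≤ b → d ≤ (a ∧̃ b)
    ∨-ub₁     : ∀ a b → a ≤ (a ∨̃ b)
    ∨-ub₂     : ∀ a b → b ≤ (a ∨̃ b)
    ∨-lub     : ∀ a b d → a ≤ d → b ≤ d → (a ∨̃ b) ≤ d
    ∀-lb      : ∀ (A : Pred B c) x → x ∈ A → ∀̃ A ≤ x
    ∀-glb     : ∀ (A : Pred B c) b → (∀ x → x ∈ A → b ≤ x) → b ≤ ∀̃ A
    ∃-ub      : ∀ (E : Pred B c) x → x ∈ E → x ≤ ∃̃ E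
    ∃-lub     : ∀ (E : Pred B c) b → (∀ x → x ∈ E → x ≤ b) → ∃̃ E ≤ b
    ⇒-adj₁    : ∀ a b d → a ≤ (b ⇒̃ d) → (a ∧̃ b) ≤ d
    ⇒-adj₂    : ∀ a b d → (a ∧̃ b) ≤ d → a ≤ (b ⇒̃ d)

record FullPHA (c ℓ : Level) : Set (lsuc (c ⊔ ℓ)) where
  infixl 5 _⇒̃_
  field
    Carrier : Set c
    _≤_     : Carrier → Carrier → Set ℓ
    ⊤̃ ⊥̃     : Carrier
    _⇒̃_ _∧̃_ _∨̃_ : Carrier → Carrier → Carrier
    ∀̃ ∃̃     : Pred Carrier c → Carrier
    isFullPHA : IsFullPHA Carrier _≤_ ⊤̃ ⊥̃ _⇒̃_ _∧̃_ _∨̃_ ∀̃ ∃̃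

module Translation {c ℓ : Level} (𝔅 : FullPHA c ℓ) (a : FullPHA.Carrier 𝔅) where
  open FullPHA 𝔅

  dn : Carrier → Carrier
  dn b = (b ⇒̃ a) ⇒̃ a

  -- A ⇒̃ a ⇒̃ a  =  { (b ⇒̃ a) ⇒̃ a | b ∈ A }  (image of A under dn)
  dnSet : Pred Carrier c → Pred Carrier c
  dnSet A x = Σ Carrier (λ b → (b ∈ A) × (x ≡ dn b))

  _≤ₐ_ : Carrier → Carrier → Set ℓ
  b ≤ₐ d = dn b ≤ dn d

  _⇒ₐ_ : Carrier → Carrier → Carrier
  b ⇒ₐ d = dn b ⇒̃ dn d

  _∧ₐ_ : Carrier → Carrier → Carrier
  b ∧ₐ d = dn b ∧̃ dn d

  _∨ₐ_ : Carrier → Carrier → Carrier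
  b ∨ₐ d = dn b ∨̃ dn d

  ∀ₐ : Pred Carrier c → Carrier
  ∀ₐ A = ∀̃ (dnSet A)

  ∃ₐ : Pred Carrier c → Carrier
  ∃ₐ A = ∃̃ (dnSet A)

module Submission where

-- b ↦ (b ⇒̃ a) ⇒̃ a is a strong closure operator: it is monotone, inflationary and
-- idempotent, and j (b ⇒̃ d) ≤ b ⇒̃ j d.  Pulling the order back along any such j
-- (b ≤ⱼ d iff j b ≤ j d) and precomposing every operation with j yields a full
-- pseudo-Heyting algebra.  Lower bounds only need j to be monotone and idempotent,
-- and upper bounds only need it to be inflationary.  For the adjunction, strength
-- shows that j y ⇒̃ j d is already j-closed.

open import Defs
open import Level using (Level; _⊔_)
open import Data.Product using (Σ; _×_; _,_)
open import Relation.Binary.PropositionalEquality using (_≡_; refl)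
open import Relation.Unary using (Pred; _∈_)

module FullPHAProperties {c ℓ : Level} (𝔅 : FullPHA c ℓ) where
  open FullPHA 𝔅
  open IsFullPHA isFullPHA

  ∧-comm : ∀ x y → (x ∧̃ y) ≤ (y ∧̃ x)
  ∧-comm x y = ∧-glb y x _ (∧-lb₂ x y) (∧-lb₁ x y)

  ⇒-eval : ∀ x y → ((x ⇒̃ y) ∧̃ x) ≤ y
  ⇒-eval x y = ⇒-adj₁ (x ⇒̃ y) x y (≤-refl _)

  ⇒-antitoneˡ : ∀ {x x′} y → x′ ≤ x → (x ⇒̃ y) ≤ (x′ ⇒̃ y)
  ⇒-antitoneˡ {x} {x′} y x′≤x = ⇒-adj₂ _ _ _
    (≤-trans (∧-glb _ _ _ (∧-lb₁ (x ⇒̃ y) x′) (≤-trans (∧-lb₂ (x ⇒̃ y) x′) x′≤x))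
             (⇒-eval x y))

  ⇒-monotoneʳ : ∀ x {y y′} → y ≤ y′ → (x ⇒̃ y) ≤ (x ⇒̃ y′)
  ⇒-monotoneʳ x {y} y≤y′ = ⇒-adj₂ _ _ _ (≤-trans (⇒-eval x y) y≤y′)

  x≤[x⇒a]⇒a : ∀ x a → x ≤ ((x ⇒̃ a) ⇒̃ a)
  x≤[x⇒a]⇒a x a = ⇒-adj₂ x (x ⇒̃ a) a (≤-trans (∧-comm x (x ⇒̃ a)) (⇒-eval x a))

  x∧[y⇒a]≤[x⇒y]⇒a : ∀ x y a → (x ∧̃ (y ⇒̃ a)) ≤ ((x ⇒̃ y) ⇒̃ a)
  x∧[y⇒a]≤[x⇒y]⇒a x y a =
    ⇒-adj₂ _ _ _ (≤-trans (∧-glb _ _ _ y⇒a y′) (⇒-eval y a))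
    where
    y⇒a : ((x ∧̃ (y ⇒̃ a)) ∧̃ (x ⇒̃ y)) ≤ (y ⇒̃ a)
    y⇒a = ≤-trans (∧-lb₁ _ _) (∧-lb₂ _ _)
    y′ : ((x ∧̃ (y ⇒̃ a)) ∧̃ (x ⇒̃ y)) ≤ y
    y′ = ≤-trans (∧-glb _ _ _ (∧-lb₂ _ _) (≤-trans (∧-lb₁ _ _) (∧-lb₁ _ _)))
                 (⇒-eval x y)

  record IsStrongClosure (j : Carrier → Carrier) : Set (c ⊔ ℓ) where
    field
      monotone     : ∀ {b d} → b ≤ d → j b ≤ j d
      inflationary : ∀ b → b ≤ j b
      idempotent   : ∀ b → j (j b) ≤ j b
      strong       : ∀ b d → j (b ⇒̃ d) ≤ (b ⇒̃ j d)

  module Pullback (j : Carrier → Carrier) where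

    image : Pred Carrier c → Pred Carrier c
    image A x = Σ Carrier (λ b → (b ∈ A) × (x ≡ j b))

    _≤ⱼ_ : Carrier → Carrier → Set ℓ
    b ≤ⱼ d = j b ≤ j d

    _⇒ⱼ_ _∧ⱼ_ _∨ⱼ_ : Carrier → Carrier → Carrier
    b ⇒ⱼ d = j b ⇒̃ j d
    b ∧ⱼ d = j b ∧̃ j d
    b ∨ⱼ d = j b ∨̃ j d

    ∀ⱼ ∃ⱼ : Pred Carrier c → Carrier
    ∀ⱼ A = ∀̃ (image A)
    ∃ⱼ A = ∃̃ (image A)

    module _ (closure : IsStrongClosure j) where
      open IsStrongClosure closure

      extend : ∀ {b d} → b ≤ j d → j b ≤ j d
      extend {d = d} b≤jd = ≤-trans (monotone b≤jd) (idempotent d)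

      ≤-close : ∀ {b d} → b ≤ d → b ≤ j d
      ≤-close {d = d} b≤d = ≤-trans b≤d (inflationary d)

      ⇒-closed : ∀ b d → j (b ⇒̃ j d) ≤ (b ⇒̃ j d)
      ⇒-closed b d = ≤-trans (strong b (j d)) (⇒-monotoneʳ b (idempotent d))

      pullback-isFullPHA : IsFullPHA Carrier _≤ⱼ_ ⊤̃ ⊥̃ _⇒ⱼ_ _∧ⱼ_ _∨ⱼ_ ∀ⱼ ∃ⱼ
      pullback-isFullPHA = record
        { ≤-refl  = λ b → ≤-refl (j b)
        ; ≤-trans = ≤-trans
        ; ≤-⊤     = λ b → monotone (≤-⊤ b)
        ; ⊥-≤     = λ b → monotone (⊥-≤ b)
        ; ∧-lb₁   = λ x y → extend (∧-lb₁ (j x) (j y))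
        ; ∧-lb₂   = λ x y → extend (∧-lb₂ (j x) (j y))
        ; ∧-glb   = λ x y d p q → ≤-close (∧-glb (j x) (j y) (j d) p q)
        ; ∨-ub₁   = λ x y → ≤-close (∨-ub₁ (j x) (j y))
        ; ∨-ub₂   = λ x y → ≤-close (∨-ub₂ (j x) (j y))
        ; ∨-lub   = λ x y d p q → extend (∨-lub (j x) (j y) (j d) p q)
        ; ∀-lb    = λ A x x∈A → extend (∀-lb (image A) (j x) (x , x∈A , refl))
        ; ∀-glb   = λ A b h → ≤-close
                      (∀-glb (image A) (j b) λ { _ (y , y∈A , refl) → h y y∈A })
        ; ∃-ub    = λ E x x∈E → ≤-close (∃-ub (image E) (j x) (x , x∈E , refl))
        ; ∃-lub   = λ E b h → extend
                      (∃-lub (image E) (j b) λ { _ (y , y∈E , refl) → h y y∈E })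
        ; ⇒-adj₁  = λ x y d p → extend
                      (⇒-adj₁ (j x) (j y) (j d) (≤-trans p (⇒-closed (j y) d)))
        ; ⇒-adj₂  = λ x y d p → ≤-close
                      (⇒-adj₂ (j x) (j y) (j d) (≤-trans (inflationary _) p))
        }

  dn-isStrongClosure : ∀ a → IsStrongClosure (Translation.dn 𝔅 a)
  dn-isStrongClosure a = record
    { monotone     = λ b≤d → ⇒-antitoneˡ a (⇒-antitoneˡ a b≤d)
    ; inflationary = λ b → x≤[x⇒a]⇒a b a
    ; idempotent   = λ b → ⇒-antitoneˡ a (x≤[x⇒a]⇒a (b ⇒̃ a) a)
    ; strong       = dn-strong
    }
    where
    dn = Translation.dn 𝔅 a
    dn-strong : ∀ x y → dn (x ⇒̃ y) ≤ (x ⇒̃ dn y)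
    dn-strong x y = ⇒-adj₂ _ _ _ (⇒-adj₂ _ _ _
      (≤-trans (∧-glb _ _ _ dn[x⇒y] [x⇒y]⇒a) (⇒-eval ((x ⇒̃ y) ⇒̃ a) a)))
      where
      dn[x⇒y] : ((dn (x ⇒̃ y) ∧̃ x) ∧̃ (y ⇒̃ a)) ≤ dn (x ⇒̃ y)
      dn[x⇒y] = ≤-trans (∧-lb₁ _ _) (∧-lb₁ _ _)
      [x⇒y]⇒a : ((dn (x ⇒̃ y) ∧̃ x) ∧̃ (y ⇒̃ a)) ≤ ((x ⇒̃ y) ⇒̃ a)
      [x⇒y]⇒a = ≤-trans (∧-glb _ _ _ (≤-trans (∧-lb₁ _ _) (∧-lb₂ _ _)) (∧-lb₂ _ _))
                        (x∧[y⇒a]≤[x⇒y]⇒a x y a)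

proposition2 : {c ℓ : Level} (𝔅 : FullPHA c ℓ) (a : FullPHA.Carrier 𝔅) →
    IsFullPHA (FullPHA.Carrier 𝔅) (Translation._≤ₐ_ 𝔅 a) (FullPHA.⊤̃ 𝔅) (FullPHA.⊥̃ 𝔅)
      (Translation._⇒ₐ_ 𝔅 a) (Translation._∧ₐ_ 𝔅 a) (Translation._∨ₐ_ 𝔅 a)
      (Translation.∀ₐ 𝔅 a) (Translation.∃ₐ 𝔅 a)
proposition2 𝔅 a =
  Pullback.pullback-isFullPHA (Translation.dn 𝔅 a) (dn-isStrongClosure a)
  where open FullPHAProperties 𝔅
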